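{- Let $F\subset K^n$ and $H\subset K^m$ be $q$-varieties and let $\mathrm{Mor}(F,H)$ be the $\mathbb{F}_q$-vector space of morphisms from $F$ to $H$. Then there is a functorial isomorphism of $\mathbb{F}_q$-vector spaces $$\mathrm{Mor}(F,H)\simeq\mathrm{Hom}_{K\{\tau\}}\big(\Lambda_m/M(H),\ \Lambda_n/M(F)\big).$$
   Context: $p$ prime, $K$ algebraically closed of characteristic $p$, $q$ a power of $p$, $\mathbb{F}_q\subset K$. $K\{\tau\}$ is the ring (under composition) of $\mathbb{F}_q$-linear polynomials $\sum_{i=0}^d a_iX^{q^i}$, $a_i\in K$, with $\tau=X^q$. $\Lambda_n$ is the set of polynomials $\sum_{i=1}^nP_i(X_i)$ with $P_i\in K\{\tau\}$, a left $K\{\tau\}$-module via $P\cdot f=P\circ f$. A $q$-variety in $K^n$ is a set $Z(S)=\{x\in K^n: f(x)=0\ \forall f\in S\}$, $S\subset\Lambda_n$. $M(F)=\{f\in\Lambda_n: f(x)=0\ \forall x\in F\}$. A morphism $F\to H$ is a map $\psi:F\to H$ for which there exist $f_1,\dots,f_m\in\Lambda_n$ with $\psi(x)=(f_1(x),\dots,f_m(x))$ for all $x\in F$. -}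

module Defs where

open import Level using (0ℓ)
open import Algebra.Bundles using (CommutativeRing)
open import Data.Nat as ℕ using (ℕ; zero; suc; _≥_)
open import Data.Nat.Primality using (Prime)
open import Data.Fin using (Fin; zero; suc; _≟_)
open import Data.List using (List; []; _∷_; map; length)
open import Data.Product using (Σ; _×_)
open import Relation.Nullary using (¬_; yes; no)

module RingOps (R : CommutativeRing 0ℓ 0ℓ) where
  open CommutativeRing R using (_+_; _*_; 0#; 1#) renaming (Carrier to K)
  natK : ℕ → K
  natK zero    = 0#
  natK (suc n) = 1# + natK n
  pow : K → ℕ → K
  pow x zero    = 1#
  pow x (suc n) = x * pow x n
  evalOrd : List K → K → K
  evalOrd []       x = 0#
  evalOrd (c ∷ cs) x = c + x * evalOrd cs x

-- The standing setting: K an algebraically closed field of characteristic p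
-- (p prime), q = p^e with e ≥ 1.  (F_q ⊂ K is then automatic: F_q is the set
-- of roots of X^q - X, see FqScalar below.)
record Setting : Set₁ where
  field
    KR : CommutativeRing 0ℓ 0ℓ
  open CommutativeRing KR public using (_≈_; _+_; _*_; -_; 0#; 1#) renaming (Carrier to K)
  open RingOps KR public
  field
    1≉0   : ¬ (1# ≈ 0#)
    inv   : ∀ (x : K) → ¬ (x ≈ 0#) → Σ K (λ y → x * y ≈ 1#)
  field
    p      : ℕ
    p-prime : Prime p
    char-p : natK p ≈ 0#
    -- algebraically closed: every monic polynomial X^d + c_{d-1}X^{d-1}+…+c₀
    -- of degree d = length cs ≥ 1 has a root
    algClosed : ∀ (cs : List K) → length cs ≥ 1 →
                Σ K (λ x → pow x (length cs) + evalOrd cs x ≈ 0#)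
    e      : ℕ
    e≥1    : e ≥ 1
  q : ℕ
  q = p ℕ.^ e

module Theory (𝒮 : Setting) where
  open Setting 𝒮 public

  FqScalar : K → Set
  FqScalar c = pow c q ≈ c

  -- K{τ}: additive polynomials Σ a_i X^{q^i}, as coefficient lists a₀ ∷ a₁ ∷ …
  Kτ : Set
  Kτ = List K

  coeff : Kτ → ℕ → K
  coeff []       _       = 0#
  coeff (a ∷ as) zero    = a
  coeff (a ∷ as) (suc i) = coeff as i

  _≈τ_ : Kτ → Kτ → Set
  P ≈τ Q = ∀ i → coeff P i ≈ coeff Q i

  evalτ : Kτ → K → K
  evalτ []       x = 0#
  evalτ (a ∷ as) x = a * x + evalτ as (pow x q)

  _+τ_ : Kτ → Kτ → Kτ
  []       +τ Q        = Q
  (a ∷ P)  +τ []       = a ∷ P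
  (a ∷ P)  +τ (b ∷ Q)  = (a + b) ∷ (P +τ Q)

  -τ_ : Kτ → Kτ
  -τ P = map (-_) P

  _·τ_ : K → Kτ → Kτ
  c ·τ P = map (c *_) P

  -- τ ∘ R  (Frobenius-twist the coefficients and shift)
  τ∘ : Kτ → Kτ
  τ∘ R = 0# ∷ map (λ b → pow b q) R

  -- composition P ∘ Q in K{τ}:  (a + τ∘P') ∘ Q = a·Q + τ∘(P' ∘ Q)
  _∘τ_ : Kτ → Kτ → Kτ
  []       ∘τ Q = []
  (a ∷ P)  ∘τ Q = (a ·τ Q) +τ τ∘ (P ∘τ Q)

  -- Λ_n : Σ_i P_i(X_i)
  Λ : ℕ → Set
  Λ n = Fin n → Kτ

  Pt : ℕ → Set
  Pt n = Fin n → K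

  sumFin : ∀ {n} → (Fin n → K) → K
  sumFin {zero}  f = 0#
  sumFin {suc n} f = f zero + sumFin (λ i → f (suc i))

  evalΛ : ∀ {n} → Λ n → Pt n → K
  evalΛ f x = sumFin (λ i → evalτ (f i) (x i))

  _+Λ_ : ∀ {n} → Λ n → Λ n → Λ n
  (f +Λ g) i = f i +τ g i

  _-Λ_ : ∀ {n} → Λ n → Λ n → Λ n
  (f -Λ g) i = f i +τ (-τ g i)

  _·Λ_ : ∀ {n} → Kτ → Λ n → Λ n
  (P ·Λ f) i = P ∘τ f i

  _⋆Λ_ : ∀ {n} → K → Λ n → Λ n
  (c ⋆Λ f) i = c ·τ f i

  -- q-varieties Z(S), S ⊂ Λ_n
  record QVar (n : ℕ) : Set₁ where
    field
      S : Λ n → Set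

  _∈Z_ : ∀ {n} → Pt n → QVar n → Set
  x ∈Z F = ∀ f → QVar.S F f → evalΛ f x ≈ 0#

  inM : ∀ {n} → QVar n → Λ n → Set
  inM F f = ∀ x → x ∈Z F → evalΛ f x ≈ 0#

  -- congruence modulo M(F) (equality in Λ_n / M(F))
  _~[_]_ : ∀ {n} → Λ n → QVar n → Λ n → Set
  f ~[ F ] g = inM F (f -Λ g)

  applyΛ : ∀ {n m} → (Fin m → Λ n) → Pt n → Pt m
  applyΛ g x j = evalΛ (g j) x

  record Mor {n m} (F : QVar n) (H : QVar m) : Set where
    field
      g    : Fin m → Λ n
      maps : ∀ x → x ∈Z F → applyΛ g x ∈Z H

  app : ∀ {n m} {F : QVar n} {H : QVar m} → Mor F H → Pt n → Pt m
  app ψ = applyΛ (Mor.g ψ)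

  _≈Mor_ : ∀ {n m} {F : QVar n} {H : QVar m} → Mor F H → Mor F H → Set
  _≈Mor_ {F = F} ψ ψ' = ∀ x → x ∈Z F → ∀ j → app ψ x j ≈ app ψ' x j

  -- Hom_{K{τ}}(Λ_m / M(H), Λ_n / M(F)), via representatives
  record Hom {n m} (F : QVar n) (H : QVar m) : Set where
    field
      φ    : Λ m → Λ n
      wd   : ∀ f f' → f ~[ H ] f' → φ f ~[ F ] φ f'
      add  : ∀ f f' → φ (f +Λ f') ~[ F ] (φ f +Λ φ f')
      lin  : ∀ (P : Kτ) f → φ (P ·Λ f) ~[ F ] (P ·Λ φ f)

  _≈Hom_ : ∀ {n m} {F : QVar n} {H : QVar m} → Hom F H → Hom F H → Set
  _≈Hom_ {m = m} {F = F} a b = ∀ (f : Λ m) → Hom.φ a f ~[ F ] Hom.φ b f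

-- Since q is a power of the characteristic, x ↦ x ^ q is additive, so every element of Λ_n
-- evaluates to an additive map Kⁿ → K, and f ≡ f' modulo M(F) exactly when f and f' agree on F.
-- A morphism ψ = (g_1, …, g_m) acts on Λ_m by substitution f ↦ f ∘ g, whose value at x is f (ψ x);
-- every required identity then follows by evaluating both sides at the points of F. Conversely,
-- a module map φ is determined by the images g_j = φ X_j of the coordinates, since up to evaluation
-- Λ_m is generated by the X_j as a K{τ}-module; so φ f agrees with f ∘ g on F for every f, which
-- shows at once that g maps F into H and that φ is the image of g.
module Submission where

open import Level using (0ℓ)
open import Algebra.Bundles using (CommutativeRing)
open import Data.Nat as ℕ using (zero; suc; _<_)
open import Data.Nat.Divisibility using (_∣_; divides)
open import Data.Nat.Primality using (Prime)
open import Data.Fin using (Fin; zero; suc)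
open import Data.List using ([]; _∷_; map)
import Relation.Binary.PropositionalEquality as ≡
open import Defs

module _ where
  open import Data.Nat using (_≤_; _*_; _∸_; _!; NonZero)
  open import Data.Nat.Properties using (<⇒≤; <⇒≱; <-trans; n<1+n; ∸-monoʳ-<; _!*_!≢0)
  open import Data.Nat.DivMod using (m/n*n≡m)
  open import Data.Nat.Divisibility using (∣⇒≤; ∣1⇒≡1; m∣m*n)
  open import Data.Nat.Primality using (prime; euclidsLemma; prime⇒nonZero)
  open import Data.Nat.Base using (nonTrivial⇒≢1)
  open import Data.Nat.Combinatorics using (_C_; nCk≡n!/k![n-k]!; k![n∸k]!∣n!)
  open import Data.Sum using (inj₁; inj₂)
  open import Data.Empty using (⊥-elim)
  open import Relation.Nullary using (¬_)

  prime∤! : ∀ {p} → Prime p → ∀ m → m < p → ¬ p ∣ m !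
  prime∤! {p} (prime _) zero    _   p∣1  = nonTrivial⇒≢1 {p} (∣1⇒≡1 p∣1)
  prime∤! pp           (suc m) m<p p∣m! with euclidsLemma (suc m) (m !) pp p∣m!
  ... | inj₁ p∣1+m = <⇒≱ m<p (∣⇒≤ p∣1+m)
  ... | inj₂ p∣m!  = prime∤! pp m (<-trans (n<1+n m) m<p) p∣m!

  n∣n! : ∀ n → .{{NonZero n}} → n ∣ n !
  n∣n! (suc n) = m∣m*n (n !)

  nCk*k!*[n∸k]!≡n! : ∀ {n k} → k ≤ n → (n C k) * (k ! * (n ∸ k) !) ≡.≡ n !
  nCk*k!*[n∸k]!≡n! {n} {k} k≤n =
    ≡.trans (≡.cong (_* (k ! * (n ∸ k) !)) (nCk≡n!/k![n-k]! k≤n)) (m/n*n≡m (k![n∸k]!∣n! k≤n))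
    where instance _ = k !* (n ∸ k) !≢0

  prime∣C : ∀ {p} → Prime p → ∀ k → 0 < k → k < p → p ∣ (p C k)
  prime∣C {p} pp k 0<k k<p with euclidsLemma (p C k) (k ! * (p ∸ k) !) pp p∣C*k!*[p∸k]!
    where
    p∣C*k!*[p∸k]! : p ∣ (p C k) * (k ! * (p ∸ k) !)
    p∣C*k!*[p∸k]! = ≡.subst (p ∣_) (≡.sym (nCk*k!*[n∸k]!≡n! (<⇒≤ k<p))) (n∣n! p {{prime⇒nonZero pp}})
  ... | inj₁ p∣C             = p∣C
  ... | inj₂ p∣k!*[p∸k]! with euclidsLemma (k !) ((p ∸ k) !) pp p∣k!*[p∸k]!
  ...   | inj₁ p∣k!     = ⊥-elim (prime∤! pp k k<p p∣k!)
  ...   | inj₂ p∣[p∸k]! = ⊥-elim (prime∤! pp (p ∸ k) (∸-monoʳ-< 0<k (<⇒≤ k<p)) p∣[p∸k]!)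

module Frobenius (R : CommutativeRing 0ℓ 0ℓ) where
  open CommutativeRing R renaming (Carrier to K) hiding (zero)
  open RingOps R
  open import Algebra.Properties.Semiring.Exp semiring using (_^_; ^-congˡ; ^-assocʳ)
  open import Algebra.Properties.CommutativeSemiring.Exp commutativeSemiring using (^-distrib-*)
  open import Algebra.Properties.Semiring.Mult semiring using (_×_; ×-congʳ; ×-assoc-*; ×1-homo-*; ×-homo-1)
  open import Algebra.Properties.Semiring.Sum semiring using (sum; sum-cong-≋; sum-init-last; sum-replicate-zero)
  open import Algebra.Properties.CommutativeSemiring.Binomial commutativeSemiring using (theorem; binomialTerm)
  open import Relation.Binary.Reasoning.Setoid setoid
  open import Data.Nat using (s≤s; z≤n)
  open import Data.Nat.Properties using (n∸n≡0)
  open import Data.Nat.Primality using (¬prime[0]; ¬prime[1])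
  open import Data.Nat.Combinatorics using (nCn≡1)
  open import Data.Fin using (toℕ; inject₁; fromℕ)
  open import Data.Fin.Properties using (toℕ-inject₁; toℕ<n; toℕ-fromℕ)
  open import Data.Empty using (⊥-elim)

  pow≡^ : ∀ x n → pow x n ≡.≡ x ^ n
  pow≡^ x zero    = ≡.refl
  pow≡^ x (suc n) = ≡.cong (x *_) (pow≡^ x n)

  pow-congˡ : ∀ n {x y} → x ≈ y → pow x n ≈ pow y n
  pow-congˡ n {x} {y} x≈y rewrite pow≡^ x n | pow≡^ y n = ^-congˡ n x≈y

  pow-distrib-* : ∀ x y n → pow (x * y) n ≈ pow x n * pow y n
  pow-distrib-* x y n rewrite pow≡^ (x * y) n | pow≡^ x n | pow≡^ y n = ^-distrib-* x y n

  pow-assocʳ : ∀ x m n → pow (pow x m) n ≈ pow x (m ℕ.* n)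
  pow-assocʳ x m n rewrite pow≡^ (pow x m) n | pow≡^ x m | pow≡^ x (m ℕ.* n) = ^-assocʳ x m n

  natK≡×1 : ∀ n → natK n ≡.≡ n × 1#
  natK≡×1 zero    = ≡.refl
  natK≡×1 (suc n) = ≡.cong (1# +_) (natK≡×1 n)

  char∣⇒×≈0 : ∀ {n c} → natK n ≈ 0# → n ∣ c → ∀ z → c × z ≈ 0#
  char∣⇒×≈0 {n} char-n (divides t ≡.refl) z = begin
    (t ℕ.* n) × z                  ≈⟨ ×-congʳ (t ℕ.* n) (*-identityˡ z) ⟨
    (t ℕ.* n) × (1# * z)           ≈⟨ ×-assoc-* (t ℕ.* n) 1# z ⟨
    ((t ℕ.* n) × 1#) * z           ≈⟨ *-congʳ (×1-homo-* t n) ⟩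
    ((t × 1#) * (n × 1#)) * z      ≡⟨ ≡.cong (λ c → ((t × 1#) * c) * z) (natK≡×1 n) ⟨
    ((t × 1#) * natK n) * z        ≈⟨ *-congʳ (*-congˡ char-n) ⟩
    ((t × 1#) * 0#) * z            ≈⟨ *-congʳ (zeroʳ _) ⟩
    0# * z                         ≈⟨ zeroˡ z ⟩
    0#                             ∎

  pow-+-prime : ∀ {p} → Prime p → natK p ≈ 0# → ∀ x y → pow (x + y) p ≈ pow x p + pow y p
  pow-+-prime {zero}        p-prime = ⊥-elim (¬prime[0] p-prime)
  pow-+-prime {suc zero}    p-prime = ⊥-elim (¬prime[1] p-prime)
  pow-+-prime {p@(suc (suc r))} p-prime char-p x y
    rewrite pow≡^ (x + y) p | pow≡^ x p | pow≡^ y p = begin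
      (x + y) ^ p                                        ≈⟨ theorem p x y ⟩
      T zero + sum (λ i → T (suc i))                     ≈⟨ +-congˡ (sum-init-last (λ i → T (suc i))) ⟩
      T zero + (sum (λ i → T (suc (inject₁ i))) + T (suc (fromℕ (suc r))))
                                                         ≈⟨ +-cong first (+-cong (sum-cong-≋ middle) last) ⟩
      y ^ p + (sum {suc r} (λ _ → 0#) + x ^ p)           ≈⟨ +-congˡ (+-congʳ (sum-replicate-zero (suc r))) ⟩
      y ^ p + (0# + x ^ p)                               ≈⟨ +-congˡ (+-identityˡ _) ⟩
      y ^ p + x ^ p                                      ≈⟨ +-comm _ _ ⟩
      x ^ p + y ^ p                                      ∎
    where
    T = binomialTerm x y p
    first : T zero ≈ y ^ p
    first = trans (×-homo-1 _) (*-identityˡ _)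
    middle : ∀ i → T (suc (inject₁ i)) ≈ 0#
    middle i = char∣⇒×≈0 char-p (prime∣C p-prime (suc (toℕ (inject₁ i))) (s≤s z≤n) k<p) _
      where
      k<p : suc (toℕ (inject₁ i)) < p
      k<p = ≡.subst (λ k → suc k < p) (≡.sym (toℕ-inject₁ i)) (s≤s (toℕ<n i))
    last : T (suc (fromℕ (suc r))) ≈ x ^ p
    last rewrite toℕ-fromℕ r | nCn≡1 p | n∸n≡0 p = trans (×-homo-1 _) (*-identityʳ _)

  pow-+-prime^ : ∀ {p} → Prime p → natK p ≈ 0# →
                 ∀ e x y → pow (x + y) (p ℕ.^ e) ≈ pow x (p ℕ.^ e) + pow y (p ℕ.^ e)
  pow-+-prime^ p-prime char-p zero x y =
    trans (*-identityʳ _) (sym (+-cong (*-identityʳ x) (*-identityʳ y)))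
  pow-+-prime^ {p} p-prime char-p (suc e) x y = begin
    pow (x + y) (p ℕ.* q)              ≈⟨ pow-assocʳ (x + y) p q ⟨
    pow (pow (x + y) p) q              ≈⟨ pow-congˡ q (pow-+-prime p-prime char-p x y) ⟩
    pow (pow x p + pow y p) q          ≈⟨ pow-+-prime^ p-prime char-p e (pow x p) (pow y p) ⟩
    pow (pow x p) q + pow (pow y p) q  ≈⟨ +-cong (pow-assocʳ x p q) (pow-assocʳ y p q) ⟩
    pow x (p ℕ.* q) + pow y (p ℕ.* q)  ∎
    where q = p ℕ.^ e

module Evaluation (𝒮 : Setting) where
  open Theory 𝒮
  open CommutativeRing KR using (_-_; setoid; refl; sym; trans; reflexive; +-cong; +-congˡ;
    *-congˡ; *-congʳ; +-identityˡ; +-identityʳ; *-assoc; *-identityˡ; zeroˡ; zeroʳ; distribˡ; distribʳ;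
    -‿cong; semiring; ring; +-abelianGroup; +-commutativeSemigroup; *-commutativeSemigroup)
  open import Algebra.Properties.Ring ring using (-‿distribˡ-*; x+x≈x⇒x≈0)
  open import Algebra.Properties.AbelianGroup +-abelianGroup using (⁻¹-∙-comm; x∙y⁻¹≈ε⇒x≈y; x≈y⇒x∙y⁻¹≈ε)
  open import Algebra.Properties.CommutativeSemigroup +-commutativeSemigroup using (interchange)
  open import Algebra.Properties.CommutativeSemigroup *-commutativeSemigroup using (x∙yz≈y∙xz)
  open import Algebra.Properties.Semiring.Sum semiring using (sum; sum-cong-≋; ∑-distrib-+; ∑-comm; sum-replicate-zero)
  open import Relation.Binary.Reasoning.Setoid setoid
  open Frobenius KR using (pow-congˡ; pow-distrib-*; pow-+-prime^)

  frob : K → K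
  frob x = pow x q

  sumFin≡sum : ∀ {n} (f : Fin n → K) → sumFin f ≡.≡ sum f
  sumFin≡sum {zero}  f = ≡.refl
  sumFin≡sum {suc n} f = ≡.cong (f zero +_) (sumFin≡sum (λ i → f (suc i)))

  sumFin-cong : ∀ {n} {f g : Fin n → K} → (∀ i → f i ≈ g i) → sumFin f ≈ sumFin g
  sumFin-cong {f = f} {g} f≈g = begin
    sumFin f  ≡⟨ sumFin≡sum f ⟩
    sum f     ≈⟨ sum-cong-≋ f≈g ⟩
    sum g     ≡⟨ sumFin≡sum g ⟨
    sumFin g  ∎

  sumFin-+ : ∀ {n} (f g : Fin n → K) → sumFin (λ i → f i + g i) ≈ sumFin f + sumFin g
  sumFin-+ f g = begin
    sumFin (λ i → f i + g i)  ≡⟨ sumFin≡sum (λ i → f i + g i) ⟩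
    sum (λ i → f i + g i)     ≈⟨ ∑-distrib-+ f g ⟩
    sum f + sum g             ≡⟨ ≡.cong₂ _+_ (sumFin≡sum f) (sumFin≡sum g) ⟨
    sumFin f + sumFin g       ∎

  sumFin-comm : ∀ {n m} (f : Fin n → Fin m → K) →
                sumFin (λ i → sumFin (f i)) ≈ sumFin (λ j → sumFin (λ i → f i j))
  sumFin-comm f = begin
    sumFin (λ i → sumFin (f i))          ≈⟨ sumFin-cong (λ i → reflexive (sumFin≡sum (f i))) ⟩
    sumFin (λ i → sum (f i))             ≡⟨ sumFin≡sum (λ i → sum (f i)) ⟩
    sum (λ i → sum (f i))                ≈⟨ ∑-comm f ⟩
    sum (λ j → sum (λ i → f i j))        ≡⟨ sumFin≡sum (λ j → sum (λ i → f i j)) ⟨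
    sumFin (λ j → sum (λ i → f i j))     ≈⟨ sumFin-cong (λ j → reflexive (sumFin≡sum (λ i → f i j))) ⟨
    sumFin (λ j → sumFin (λ i → f i j))  ∎

  sumFin-0 : ∀ n → sumFin {n} (λ _ → 0#) ≈ 0#
  sumFin-0 n = trans (reflexive (sumFin≡sum {n} _)) (sum-replicate-zero n)

  record IsAdditive (T : K → K) : Set where
    field
      cong : ∀ {x y} → x ≈ y → T x ≈ T y
      homo : ∀ x y → T (x + y) ≈ T x + T y

    0-homo : T 0# ≈ 0#
    0-homo = x+x≈x⇒x≈0 (T 0#) (trans (sym (homo 0# 0#)) (cong (+-identityˡ 0#)))

    sumFin-homo : ∀ {n} (f : Fin n → K) → T (sumFin f) ≈ sumFin (λ i → T (f i))
    sumFin-homo {zero}  f = 0-homo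
    sumFin-homo {suc n} f = trans (homo _ _) (+-congˡ (sumFin-homo (λ i → f (suc i))))

  open IsAdditive

  frob-additive : IsAdditive frob
  frob-additive = record { cong = pow-congˡ q ; homo = pow-+-prime^ p-prime char-p e }

  *-additive : ∀ c → IsAdditive (c *_)
  *-additive c = record { cong = *-congˡ ; homo = distribˡ c }

  neg-additive : IsAdditive (λ x → - x)
  neg-additive = record { cong = -‿cong ; homo = λ x y → sym (⁻¹-∙-comm x y) }

  +-additive : ∀ {T U} → IsAdditive T → IsAdditive U → IsAdditive (λ v → T v + U v)
  +-additive {T} {U} T-add U-add = record
    { cong = λ x≈y → +-cong (cong T-add x≈y) (cong U-add x≈y)
    ; homo = λ x y → begin
        T (x + y) + U (x + y)          ≈⟨ +-cong (homo T-add x y) (homo U-add x y) ⟩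
        (T x + T y) + (U x + U y)      ≈⟨ interchange (T x) (T y) (U x) (U y) ⟩
        (T x + U x) + (T y + U y)      ∎
    }

  ∘-additive : ∀ {T U} → IsAdditive T → IsAdditive U → IsAdditive (λ v → T (U v))
  ∘-additive {T} {U} T-add U-add = record
    { cong = λ x≈y → cong T-add (cong U-add x≈y)
    ; homo = λ x y → trans (cong T-add (homo U-add x y)) (homo T-add (U x) (U y))
    }

  0-additive : IsAdditive (λ _ → 0#)
  0-additive = record { cong = λ _ → refl ; homo = λ _ _ → sym (+-identityˡ 0#) }

  evalτ-additive : ∀ P → IsAdditive (evalτ P)
  evalτ-additive []      = 0-additive
  evalτ-additive (a ∷ P) = +-additive (*-additive a) (∘-additive (evalτ-additive P) frob-additive)

  -- evalτ reads a ∷ P as a + P ∘ τ, but _∘τ_ reads it as a + τ ∘ P, so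
  -- (a ∷ P) ∘τ Q evaluates through the following twisted polynomial map.
  twistedEval : Kτ → K → K
  twistedEval []      v = 0#
  twistedEval (a ∷ P) v = a * v + frob (twistedEval P v)

  twistedEval-additive : ∀ P → IsAdditive (twistedEval P)
  twistedEval-additive []      = 0-additive
  twistedEval-additive (a ∷ P) = +-additive (*-additive a) (∘-additive frob-additive (twistedEval-additive P))

  evalτ-+τ : ∀ P Q x → evalτ (P +τ Q) x ≈ evalτ P x + evalτ Q x
  evalτ-+τ []      Q       x = sym (+-identityˡ _)
  evalτ-+τ (a ∷ P) []      x = sym (+-identityʳ _)
  evalτ-+τ (a ∷ P) (b ∷ Q) x = begin
    (a + b) * x + evalτ (P +τ Q) (frob x)                  ≈⟨ +-cong (distribʳ x a b) (evalτ-+τ P Q (frob x)) ⟩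
    (a * x + b * x) + (evalτ P (frob x) + evalτ Q (frob x)) ≈⟨ interchange _ _ _ _ ⟩
    (a * x + evalτ P (frob x)) + (b * x + evalτ Q (frob x)) ∎

  evalτ-·τ : ∀ c P x → evalτ (c ·τ P) x ≈ c * evalτ P x
  evalτ-·τ c []      x = sym (zeroʳ c)
  evalτ-·τ c (a ∷ P) x = trans (+-cong (*-assoc c a x) (evalτ-·τ c P (frob x))) (sym (distribˡ c _ _))

  evalτ--τ : ∀ P x → evalτ (-τ P) x ≈ - evalτ P x
  evalτ--τ []      x = sym (0-homo neg-additive)
  evalτ--τ (a ∷ P) x =
    trans (+-cong (sym (-‿distribˡ-* a x)) (evalτ--τ P (frob x))) (sym (homo neg-additive _ _))

  evalτ-τ∘ : ∀ R x → evalτ (τ∘ R) x ≈ frob (evalτ R x)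
  evalτ-τ∘ R x = trans (+-cong (zeroˡ x) (evalτ-map-frob R x)) (+-identityˡ _)
    where
    evalτ-map-frob : ∀ R x → evalτ (map frob R) (frob x) ≈ frob (evalτ R x)
    evalτ-map-frob []      x = sym (0-homo frob-additive)
    evalτ-map-frob (b ∷ R) x = begin
      frob b * frob x + evalτ (map frob R) (frob (frob x)) ≈⟨ +-cong (sym (pow-distrib-* b x q)) (evalτ-map-frob R (frob x)) ⟩
      frob (b * x) + frob (evalτ R (frob x))                ≈⟨ homo frob-additive _ _ ⟨
      frob (b * x + evalτ R (frob x))                       ∎

  evalτ-∘τ : ∀ P Q x → evalτ (P ∘τ Q) x ≈ twistedEval P (evalτ Q x)
  evalτ-∘τ []      Q x = refl
  evalτ-∘τ (a ∷ P) Q x = begin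
    evalτ ((a ·τ Q) +τ τ∘ (P ∘τ Q)) x         ≈⟨ evalτ-+τ (a ·τ Q) (τ∘ (P ∘τ Q)) x ⟩
    evalτ (a ·τ Q) x + evalτ (τ∘ (P ∘τ Q)) x  ≈⟨ +-cong (evalτ-·τ a Q x) (evalτ-τ∘ (P ∘τ Q) x) ⟩
    a * evalτ Q x + frob (evalτ (P ∘τ Q) x)   ≈⟨ +-congˡ (cong frob-additive (evalτ-∘τ P Q x)) ⟩
    a * evalτ Q x + frob (twistedEval P (evalτ Q x))   ∎

  infixr 9 _⊚_
  _⊚_ : Kτ → Kτ → Kτ
  []      ⊚ Q = []
  (a ∷ P) ⊚ Q = (a ·τ Q) +τ (P ⊚ τ∘ Q)

  evalτ-⊚ : ∀ P Q x → evalτ (P ⊚ Q) x ≈ evalτ P (evalτ Q x)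
  evalτ-⊚ []      Q x = refl
  evalτ-⊚ (a ∷ P) Q x = begin
    evalτ ((a ·τ Q) +τ (P ⊚ τ∘ Q)) x         ≈⟨ evalτ-+τ (a ·τ Q) (P ⊚ τ∘ Q) x ⟩
    evalτ (a ·τ Q) x + evalτ (P ⊚ τ∘ Q) x    ≈⟨ +-cong (evalτ-·τ a Q x) (evalτ-⊚ P (τ∘ Q) x) ⟩
    a * evalτ Q x + evalτ P (evalτ (τ∘ Q) x) ≈⟨ +-congˡ (cong (evalτ-additive P) (evalτ-τ∘ Q x)) ⟩
    a * evalτ Q x + evalτ P (frob (evalτ Q x)) ∎

  evalτ-Fq-homo : ∀ P {c} → FqScalar c → ∀ x → evalτ P (c * x) ≈ c * evalτ P x
  evalτ-Fq-homo []      {c} c∈Fq x = sym (zeroʳ c)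
  evalτ-Fq-homo (a ∷ P) {c} c∈Fq x = begin
    a * (c * x) + evalτ P (frob (c * x))   ≈⟨ +-cong (x∙yz≈y∙xz a c x) (cong (evalτ-additive P) frob-cx≈c·frob-x) ⟩
    c * (a * x) + evalτ P (c * frob x)     ≈⟨ +-congˡ (evalτ-Fq-homo P c∈Fq (frob x)) ⟩
    c * (a * x) + c * evalτ P (frob x)     ≈⟨ distribˡ c _ _ ⟨
    c * (a * x + evalτ P (frob x))         ∎
    where
    frob-cx≈c·frob-x : frob (c * x) ≈ c * frob x
    frob-cx≈c·frob-x = trans (pow-distrib-* c x q) (*-congʳ c∈Fq)

  evalΛ-cong : ∀ {n} (f : Λ n) {x y : Pt n} → (∀ i → x i ≈ y i) → evalΛ f x ≈ evalΛ f y
  evalΛ-cong f x≈y = sumFin-cong (λ i → cong (evalτ-additive (f i)) (x≈y i))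

  evalΛ-homo : ∀ {n T} → IsAdditive T → (f f' : Λ n) (x x' : Pt n) →
               (∀ i → evalτ (f' i) (x' i) ≈ T (evalτ (f i) (x i))) → evalΛ f' x' ≈ T (evalΛ f x)
  evalΛ-homo T-add f f' x x' f'x'≈Tfx =
    trans (sumFin-cong f'x'≈Tfx) (sym (sumFin-homo T-add (λ i → evalτ (f i) (x i))))

  evalΛ-+Λ : ∀ {n} (f g : Λ n) x → evalΛ (f +Λ g) x ≈ evalΛ f x + evalΛ g x
  evalΛ-+Λ f g x = trans (sumFin-cong (λ i → evalτ-+τ (f i) (g i) (x i)))
                         (sumFin-+ (λ i → evalτ (f i) (x i)) (λ i → evalτ (g i) (x i)))

  evalΛ--Λ : ∀ {n} (f g : Λ n) x → evalΛ (f -Λ g) x ≈ evalΛ f x - evalΛ g x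
  evalΛ--Λ f g x = trans (evalΛ-+Λ f (λ i → -τ g i) x)
    (+-congˡ (evalΛ-homo neg-additive g (λ i → -τ g i) x x (λ i → evalτ--τ (g i) (x i))))

  evalΛ-·Λ : ∀ {n} P (f : Λ n) x → evalΛ (P ·Λ f) x ≈ twistedEval P (evalΛ f x)
  evalΛ-·Λ P f x = evalΛ-homo (twistedEval-additive P) f (P ·Λ f) x x (λ i → evalτ-∘τ P (f i) (x i))

  evalΛ-⋆Λ : ∀ {n} c (f : Λ n) x → evalΛ (c ⋆Λ f) x ≈ c * evalΛ f x
  evalΛ-⋆Λ c f x = evalΛ-homo (*-additive c) f (c ⋆Λ f) x x (λ i → evalτ-·τ c (f i) (x i))

  evalΛ-+-pointwise : ∀ {n} (f : Λ n) x y → evalΛ f (λ i → x i + y i) ≈ evalΛ f x + evalΛ f y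
  evalΛ-+-pointwise f x y = trans (sumFin-cong (λ i → homo (evalτ-additive (f i)) (x i) (y i)))
                                  (sumFin-+ (λ i → evalτ (f i) (x i)) (λ i → evalτ (f i) (y i)))

  evalΛ-Fq-homo : ∀ {n} (f : Λ n) {c} → FqScalar c → ∀ x → evalΛ f (λ i → c * x i) ≈ c * evalΛ f x
  evalΛ-Fq-homo f {c} c∈Fq x =
    evalΛ-homo (*-additive c) f f x (λ i → c * x i) (λ i → evalτ-Fq-homo (f i) c∈Fq (x i))

  agreeOn⇒~ : ∀ {n} (F : QVar n) (f g : Λ n) → (∀ x → x ∈Z F → evalΛ f x ≈ evalΛ g x) → f ~[ F ] g
  agreeOn⇒~ F f g f≈g x x∈F = trans (evalΛ--Λ f g x) (x≈y⇒x∙y⁻¹≈ε (f≈g x x∈F))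

  ~⇒agreeOn : ∀ {n} (F : QVar n) (f g : Λ n) → f ~[ F ] g → ∀ x → x ∈Z F → evalΛ f x ≈ evalΛ g x
  ~⇒agreeOn F f g f~g x x∈F = x∙y⁻¹≈ε⇒x≈y _ _ (trans (sym (evalΛ--Λ f g x)) (f~g x x∈F))

  zeroΛ : ∀ {m} → Λ m
  zeroΛ _ = []

  evalΛ-zeroΛ : ∀ {m} (y : Pt m) → evalΛ (zeroΛ {m}) y ≈ 0#
  evalΛ-zeroΛ {m} y = sumFin-0 m

  δ : ∀ {m} → Fin m → Λ m
  δ zero    zero    = 1# ∷ []
  δ zero    (suc i) = []
  δ (suc j) zero    = []
  δ (suc j) (suc i) = δ j i

  evalΛ-δ : ∀ {m} (j : Fin m) (y : Pt m) → evalΛ (δ j) y ≈ y j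
  evalΛ-δ {suc m} zero    y = begin
    (1# * y zero + 0#) + sumFin {m} (λ _ → 0#)  ≈⟨ +-cong (+-identityʳ _) (sumFin-0 m) ⟩
    1# * y zero + 0#                            ≈⟨ +-identityʳ _ ⟩
    1# * y zero                                 ≈⟨ *-identityˡ _ ⟩
    y zero                                      ∎
  evalΛ-δ {suc m} (suc j) y = trans (+-identityˡ _) (evalΛ-δ j (λ i → y (suc i)))

  τ : Kτ
  τ = 0# ∷ 1# ∷ []

  -- P ⊙ g is the composite P ∘ g, built from the module operations alone.
  _⊙_ : ∀ {m} → Kτ → Λ m → Λ m
  []      ⊙ g = zeroΛ
  (a ∷ P) ⊙ g = ((a ∷ []) ·Λ g) +Λ (P ⊙ (τ ·Λ g))

  evalΛ-⊙ : ∀ {m} P (g : Λ m) y → evalΛ (P ⊙ g) y ≈ evalτ P (evalΛ g y)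
  evalΛ-⊙ []      g y = evalΛ-zeroΛ y
  evalΛ-⊙ (a ∷ P) g y = begin
    evalΛ (((a ∷ []) ·Λ g) +Λ (P ⊙ (τ ·Λ g))) y          ≈⟨ evalΛ-+Λ ((a ∷ []) ·Λ g) (P ⊙ (τ ·Λ g)) y ⟩
    evalΛ ((a ∷ []) ·Λ g) y + evalΛ (P ⊙ (τ ·Λ g)) y     ≈⟨ +-cong (evalΛ-·Λ (a ∷ []) g y) (evalΛ-⊙ P (τ ·Λ g) y) ⟩
    twistedEval (a ∷ []) v + evalτ P (evalΛ (τ ·Λ g) y)  ≈⟨ +-cong twistedEval-[a] (cong (evalτ-additive P) (evalΛ-·Λ τ g y)) ⟩
    a * v + evalτ P (twistedEval τ v)                     ≈⟨ +-congˡ (cong (evalτ-additive P) twistedEval-τ) ⟩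
    a * v + evalτ P (frob v)                              ∎
    where
    v = evalΛ g y
    frob-0 : frob 0# ≈ 0#
    frob-0 = 0-homo frob-additive
    twistedEval-[a] : twistedEval (a ∷ []) v ≈ a * v
    twistedEval-[a] = trans (+-congˡ frob-0) (+-identityʳ _)
    twistedEval-τ : twistedEval τ v ≈ frob v
    twistedEval-τ = begin
      0# * v + frob (1# * v + frob 0#)  ≈⟨ +-cong (zeroˡ v) (cong frob-additive (+-cong (*-identityˡ v) frob-0)) ⟩
      0# + frob (v + 0#)                ≈⟨ +-identityˡ _ ⟩
      frob (v + 0#)                     ≈⟨ cong frob-additive (+-identityʳ v) ⟩
      frob v                            ∎

  sumΛ : ∀ {k m} → (Fin k → Λ m) → Λ m
  sumΛ {zero}  f = zeroΛ
  sumΛ {suc k} f = f zero +Λ sumΛ (λ j → f (suc j))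

  evalΛ-sumΛ : ∀ {k m} (f : Fin k → Λ m) y → evalΛ (sumΛ f) y ≈ sumFin (λ j → evalΛ (f j) y)
  evalΛ-sumΛ {zero}  f y = evalΛ-zeroΛ y
  evalΛ-sumΛ {suc k} f y = trans (evalΛ-+Λ (f zero) (sumΛ (λ j → f (suc j))) y)
                                 (+-congˡ (evalΛ-sumΛ (λ j → f (suc j)) y))

  expand : ∀ {m} → Λ m → Λ m
  expand f = sumΛ (λ j → f j ⊙ δ j)

  evalΛ-expand : ∀ {m} (f : Λ m) y → evalΛ (expand f) y ≈ evalΛ f y
  evalΛ-expand f y = trans (evalΛ-sumΛ (λ j → f j ⊙ δ j) y) (sumFin-cong λ j →
    trans (evalΛ-⊙ (f j) (δ j) y) (cong (evalτ-additive (f j)) (evalΛ-δ j y)))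

  Λ-ind : ∀ {m} (E : Λ m → Set) →
          (∀ f f' → (∀ y → evalΛ f y ≈ evalΛ f' y) → E f → E f') →
          E zeroΛ →
          (∀ f f' → E f → E f' → E (f +Λ f')) →
          (∀ P f → E f → E (P ·Λ f)) →
          (∀ j → E (δ j)) →
          ∀ f → E f
  Λ-ind {m} E E-resp E-0 E-+ E-· E-δ f =
    E-resp (expand f) f (evalΛ-expand f) (E-sumΛ (λ j → E-⊙ (f j) (E-δ j)))
    where
    E-⊙ : ∀ P {g} → E g → E (P ⊙ g)
    E-⊙ []      E-g = E-0
    E-⊙ (a ∷ P) E-g = E-+ _ _ (E-· (a ∷ []) _ E-g) (E-⊙ P (E-· τ _ E-g))
    E-sumΛ : ∀ {k} {h : Fin k → Λ m} → (∀ j → E (h j)) → E (sumΛ h)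
    E-sumΛ {zero}  E-h = E-0
    E-sumΛ {suc k} E-h = E-+ _ _ (E-h zero) (E-sumΛ (λ j → E-h (suc j)))

module Pullback (𝒮 : Setting) where
  open Theory 𝒮
  open Evaluation 𝒮
  open CommutativeRing KR using (setoid; refl; sym; trans; +-cong; +-congˡ; *-congˡ)
  open import Relation.Binary.Reasoning.Setoid setoid

  sumτ : ∀ {k} → (Fin k → Kτ) → Kτ
  sumτ {zero}  P = []
  sumτ {suc k} P = P zero +τ sumτ (λ j → P (suc j))

  evalτ-sumτ : ∀ {k} (P : Fin k → Kτ) x → evalτ (sumτ P) x ≈ sumFin (λ j → evalτ (P j) x)
  evalτ-sumτ {zero}  P x = refl
  evalτ-sumτ {suc k} P x = trans (evalτ-+τ (P zero) _ x) (+-congˡ (evalτ-sumτ (λ j → P (suc j)) x))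

  pullback : ∀ {n m} → (Fin m → Λ n) → Λ m → Λ n
  pullback g f i = sumτ (λ j → f j ⊚ g j i)

  evalΛ-pullback : ∀ {n m} (g : Fin m → Λ n) (f : Λ m) x → evalΛ (pullback g f) x ≈ evalΛ f (applyΛ g x)
  evalΛ-pullback g f x = begin
    sumFin (λ i → evalτ (sumτ (λ j → f j ⊚ g j i)) (x i))
      ≈⟨ sumFin-cong (λ i → trans (evalτ-sumτ (λ j → f j ⊚ g j i) (x i))
                                  (sumFin-cong (λ j → evalτ-⊚ (f j) (g j i) (x i)))) ⟩
    sumFin (λ i → sumFin (λ j → evalτ (f j) (evalτ (g j i) (x i))))
      ≈⟨ sumFin-comm (λ i j → evalτ (f j) (evalτ (g j i) (x i))) ⟩
    sumFin (λ j → sumFin (λ i → evalτ (f j) (evalτ (g j i) (x i))))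
      ≈⟨ sumFin-cong (λ j → IsAdditive.sumFin-homo (evalτ-additive (f j)) (λ i → evalτ (g j i) (x i))) ⟨
    evalΛ f (applyΛ g x) ∎

  module _ {n m} (F : QVar n) (g : Fin m → Λ n) where

    pullback-+Λ : ∀ f f' → pullback g (f +Λ f') ~[ F ] (pullback g f +Λ pullback g f')
    pullback-+Λ f f' = agreeOn⇒~ F (pullback g (f +Λ f')) (pullback g f +Λ pullback g f') λ x _ → begin
      evalΛ (pullback g (f +Λ f')) x                        ≈⟨ evalΛ-pullback g (f +Λ f') x ⟩
      evalΛ (f +Λ f') (applyΛ g x)                          ≈⟨ evalΛ-+Λ f f' (applyΛ g x) ⟩
      evalΛ f (applyΛ g x) + evalΛ f' (applyΛ g x)          ≈⟨ +-cong (evalΛ-pullback g f x) (evalΛ-pullback g f' x) ⟨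
      evalΛ (pullback g f) x + evalΛ (pullback g f') x      ≈⟨ evalΛ-+Λ (pullback g f) (pullback g f') x ⟨
      evalΛ (pullback g f +Λ pullback g f') x               ∎

    pullback-·Λ : ∀ P f → pullback g (P ·Λ f) ~[ F ] (P ·Λ pullback g f)
    pullback-·Λ P f = agreeOn⇒~ F (pullback g (P ·Λ f)) (P ·Λ pullback g f) λ x _ → begin
      evalΛ (pullback g (P ·Λ f)) x                  ≈⟨ evalΛ-pullback g (P ·Λ f) x ⟩
      evalΛ (P ·Λ f) (applyΛ g x)                    ≈⟨ evalΛ-·Λ P f (applyΛ g x) ⟩
      twistedEval P (evalΛ f (applyΛ g x))           ≈⟨ IsAdditive.cong (twistedEval-additive P) (evalΛ-pullback g f x) ⟨
      twistedEval P (evalΛ (pullback g f) x)         ≈⟨ evalΛ-·Λ P (pullback g f) x ⟨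
      evalΛ (P ·Λ pullback g f) x                    ∎

    pullback-~ : ∀ {H : QVar m} → (∀ x → x ∈Z F → applyΛ g x ∈Z H) →
                 ∀ f f' → f ~[ H ] f' → pullback g f ~[ F ] pullback g f'
    pullback-~ {H} g[F]⊆H f f' f~f' = agreeOn⇒~ F (pullback g f) (pullback g f') λ x x∈F → begin
      evalΛ (pullback g f) x    ≈⟨ evalΛ-pullback g f x ⟩
      evalΛ f (applyΛ g x)      ≈⟨ ~⇒agreeOn H f f' f~f' (applyΛ g x) (g[F]⊆H x x∈F) ⟩
      evalΛ f' (applyΛ g x)     ≈⟨ evalΛ-pullback g f' x ⟨
      evalΛ (pullback g f') x   ∎

  pullbackHom : ∀ {n m} (F : QVar n) (H : QVar m) → Mor F H → Hom F H
  pullbackHom F H ψ = record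
    { φ   = pullback (Mor.g ψ)
    ; wd  = pullback-~ F (Mor.g ψ) (Mor.maps ψ)
    ; add = pullback-+Λ F (Mor.g ψ)
    ; lin = pullback-·Λ F (Mor.g ψ)
    }

  module _ {n} (F : QVar n) where

    pullback-cong : ∀ {m} (g g' : Fin m → Λ n) → (∀ x → x ∈Z F → ∀ j → applyΛ g x j ≈ applyΛ g' x j) →
                    ∀ f → pullback g f ~[ F ] pullback g' f
    pullback-cong g g' g≈g' f = agreeOn⇒~ F (pullback g f) (pullback g' f) λ x x∈F → begin
      evalΛ (pullback g f) x   ≈⟨ evalΛ-pullback g f x ⟩
      evalΛ f (applyΛ g x)     ≈⟨ evalΛ-cong f (g≈g' x x∈F) ⟩
      evalΛ f (applyΛ g' x)    ≈⟨ evalΛ-pullback g' f x ⟨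
      evalΛ (pullback g' f) x  ∎

    pullback-injective : ∀ {m} (g g' : Fin m → Λ n) → (∀ f → pullback g f ~[ F ] pullback g' f) →
                         ∀ x → x ∈Z F → ∀ j → applyΛ g x j ≈ applyΛ g' x j
    pullback-injective g g' g*≈g'* x x∈F j = begin
      applyΛ g x j                    ≈⟨ evalΛ-δ j (applyΛ g x) ⟨
      evalΛ (δ j) (applyΛ g x)        ≈⟨ evalΛ-pullback g (δ j) x ⟨
      evalΛ (pullback g (δ j)) x      ≈⟨ ~⇒agreeOn F (pullback g (δ j)) (pullback g' (δ j)) (g*≈g'* (δ j)) x x∈F ⟩
      evalΛ (pullback g' (δ j)) x     ≈⟨ evalΛ-pullback g' (δ j) x ⟩
      evalΛ (δ j) (applyΛ g' x)       ≈⟨ evalΛ-δ j (applyΛ g' x) ⟩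
      applyΛ g' x j                   ∎

    pullback-+ : ∀ {m} (g g' g'' : Fin m → Λ n) →
                 (∀ x → x ∈Z F → ∀ j → applyΛ g'' x j ≈ applyΛ g x j + applyΛ g' x j) →
                 ∀ f → pullback g'' f ~[ F ] (pullback g f +Λ pullback g' f)
    pullback-+ g g' g'' g''≈g+g' f = agreeOn⇒~ F (pullback g'' f) (pullback g f +Λ pullback g' f) λ x x∈F → begin
      evalΛ (pullback g'' f) x                          ≈⟨ evalΛ-pullback g'' f x ⟩
      evalΛ f (applyΛ g'' x)                            ≈⟨ evalΛ-cong f (g''≈g+g' x x∈F) ⟩
      evalΛ f (λ j → applyΛ g x j + applyΛ g' x j)      ≈⟨ evalΛ-+-pointwise f (applyΛ g x) (applyΛ g' x) ⟩
      evalΛ f (applyΛ g x) + evalΛ f (applyΛ g' x)      ≈⟨ +-cong (evalΛ-pullback g f x) (evalΛ-pullback g' f x) ⟨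
      evalΛ (pullback g f) x + evalΛ (pullback g' f) x  ≈⟨ evalΛ-+Λ (pullback g f) (pullback g' f) x ⟨
      evalΛ (pullback g f +Λ pullback g' f) x           ∎

    pullback-Fq-homo : ∀ {m} (g g' : Fin m → Λ n) {c} → FqScalar c →
                       (∀ x → x ∈Z F → ∀ j → applyΛ g' x j ≈ c * applyΛ g x j) →
                       ∀ f → pullback g' f ~[ F ] (c ⋆Λ pullback g f)
    pullback-Fq-homo g g' {c} c∈Fq g'≈cg f = agreeOn⇒~ F (pullback g' f) (c ⋆Λ pullback g f) λ x x∈F → begin
      evalΛ (pullback g' f) x               ≈⟨ evalΛ-pullback g' f x ⟩
      evalΛ f (applyΛ g' x)                 ≈⟨ evalΛ-cong f (g'≈cg x x∈F) ⟩
      evalΛ f (λ j → c * applyΛ g x j)      ≈⟨ evalΛ-Fq-homo f c∈Fq (applyΛ g x) ⟩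
      c * evalΛ f (applyΛ g x)              ≈⟨ *-congˡ (evalΛ-pullback g f x) ⟨
      c * evalΛ (pullback g f) x            ≈⟨ evalΛ-⋆Λ c (pullback g f) x ⟨
      evalΛ (c ⋆Λ pullback g f) x           ∎

  pullback-∘ : ∀ {n m k} (F : QVar n) (g : Fin m → Λ n) (g' : Fin k → Λ m) (g'' : Fin k → Λ n) →
               (∀ x → x ∈Z F → ∀ j → applyΛ g'' x j ≈ applyΛ g' (applyΛ g x) j) →
               ∀ f → pullback g'' f ~[ F ] pullback g (pullback g' f)
  pullback-∘ F g g' g'' g''≈g'∘g f = agreeOn⇒~ F (pullback g'' f) (pullback g (pullback g' f)) λ x x∈F → begin
    evalΛ (pullback g'' f) x                  ≈⟨ evalΛ-pullback g'' f x ⟩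
    evalΛ f (applyΛ g'' x)                    ≈⟨ evalΛ-cong f (g''≈g'∘g x x∈F) ⟩
    evalΛ f (applyΛ g' (applyΛ g x))          ≈⟨ evalΛ-pullback g' f (applyΛ g x) ⟨
    evalΛ (pullback g' f) (applyΛ g x)        ≈⟨ evalΛ-pullback g (pullback g' f) x ⟨
    evalΛ (pullback g (pullback g' f)) x      ∎

  pullback-id : ∀ {n} (F : QVar n) (g : Fin n → Λ n) → (∀ x → x ∈Z F → ∀ i → applyΛ g x i ≈ x i) →
                ∀ f → pullback g f ~[ F ] f
  pullback-id F g g≈id f = agreeOn⇒~ F (pullback g f) f λ x x∈F →
    trans (evalΛ-pullback g f x) (evalΛ-cong f (g≈id x x∈F))

  module _ {n m} {F : QVar n} {H : QVar m} (h : Hom F H) where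
    open Hom h

    coordinateImages : Fin m → Λ n
    coordinateImages j = φ (δ j)

    φ-eval : ∀ f x → x ∈Z F → evalΛ (φ f) x ≈ evalΛ f (applyΛ coordinateImages x)
    φ-eval = Λ-ind E E-resp E-0 E-+ E-· E-δ
      where
      g = coordinateImages
      E : Λ m → Set
      E f = ∀ x → x ∈Z F → evalΛ (φ f) x ≈ evalΛ f (applyΛ g x)
      E-resp : ∀ f f' → (∀ y → evalΛ f y ≈ evalΛ f' y) → E f → E f'
      E-resp f f' f≈f' E-f x x∈F = begin
        evalΛ (φ f') x          ≈⟨ ~⇒agreeOn F (φ f') (φ f) (wd f' f (agreeOn⇒~ H f' f λ y _ → sym (f≈f' y))) x x∈F ⟩
        evalΛ (φ f) x           ≈⟨ E-f x x∈F ⟩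
        evalΛ f (applyΛ g x)    ≈⟨ f≈f' (applyΛ g x) ⟩
        evalΛ f' (applyΛ g x)   ∎
      -- zeroΛ is [] ·Λ zeroΛ, so linearity pins down φ zeroΛ.
      E-0 : E zeroΛ
      E-0 x x∈F = begin
        evalΛ (φ zeroΛ) x              ≈⟨ ~⇒agreeOn F (φ zeroΛ) ([] ·Λ φ zeroΛ) (lin [] zeroΛ) x x∈F ⟩
        evalΛ ([] ·Λ φ zeroΛ) x        ≈⟨ evalΛ-·Λ [] (φ zeroΛ) x ⟩
        0#                             ≈⟨ evalΛ-zeroΛ (applyΛ g x) ⟨
        evalΛ zeroΛ (applyΛ g x)       ∎
      E-+ : ∀ f f' → E f → E f' → E (f +Λ f')
      E-+ f f' E-f E-f' x x∈F = begin
        evalΛ (φ (f +Λ f')) x                        ≈⟨ ~⇒agreeOn F (φ (f +Λ f')) (φ f +Λ φ f') (add f f') x x∈F ⟩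
        evalΛ (φ f +Λ φ f') x                        ≈⟨ evalΛ-+Λ (φ f) (φ f') x ⟩
        evalΛ (φ f) x + evalΛ (φ f') x               ≈⟨ +-cong (E-f x x∈F) (E-f' x x∈F) ⟩
        evalΛ f (applyΛ g x) + evalΛ f' (applyΛ g x) ≈⟨ evalΛ-+Λ f f' (applyΛ g x) ⟨
        evalΛ (f +Λ f') (applyΛ g x)                 ∎
      E-· : ∀ P f → E f → E (P ·Λ f)
      E-· P f E-f x x∈F = begin
        evalΛ (φ (P ·Λ f)) x                ≈⟨ ~⇒agreeOn F (φ (P ·Λ f)) (P ·Λ φ f) (lin P f) x x∈F ⟩
        evalΛ (P ·Λ φ f) x                  ≈⟨ evalΛ-·Λ P (φ f) x ⟩
        twistedEval P (evalΛ (φ f) x)       ≈⟨ IsAdditive.cong (twistedEval-additive P) (E-f x x∈F) ⟩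
        twistedEval P (evalΛ f (applyΛ g x)) ≈⟨ evalΛ-·Λ P f (applyΛ g x) ⟨
        evalΛ (P ·Λ f) (applyΛ g x)         ∎
      E-δ : ∀ j → E (δ j)
      E-δ j x _ = sym (evalΛ-δ j (applyΛ g x))

    homToMor : Mor F H
    homToMor = record { g = coordinateImages ; maps = maps }
      where
      maps : ∀ x → x ∈Z F → applyΛ coordinateImages x ∈Z H
      maps x x∈F f f∈S = begin
        evalΛ f (applyΛ coordinateImages x)      ≈⟨ φ-eval f x x∈F ⟨
        evalΛ (φ f) x                            ≈⟨ ~⇒agreeOn F (φ f) (φ zeroΛ) (wd f zeroΛ f~0) x x∈F ⟩
        evalΛ (φ zeroΛ) x                        ≈⟨ φ-eval zeroΛ x x∈F ⟩
        evalΛ zeroΛ (applyΛ coordinateImages x)  ≈⟨ evalΛ-zeroΛ (applyΛ coordinateImages x) ⟩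
        0#                                       ∎
        where
        f~0 : f ~[ H ] zeroΛ
        f~0 = agreeOn⇒~ H f zeroΛ λ y y∈H → trans (y∈H f f∈S) (sym (evalΛ-zeroΛ y))

    pullbackHom-homToMor : pullbackHom F H homToMor ≈Hom h
    pullbackHom-homToMor f = agreeOn⇒~ F (pullback coordinateImages f) (φ f) λ x x∈F →
      trans (evalΛ-pullback coordinateImages f x) (sym (φ-eval f x x∈F))

open import Data.Product using (Σ; _×_; _,_)
open import Function using (_∘_; id)

theorem2p14 : (𝒮 : Setting) → let open Theory 𝒮 in
  Σ (∀ {n m} (F : QVar n) (H : QVar m) → Mor F H → Hom F H) λ Φ →
    -- Φ is well defined on morphisms (maps F → H)
    (∀ {n m} (F : QVar n) (H : QVar m) (ψ ψ' : Mor F H) →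
       ψ ≈Mor ψ' → Φ F H ψ ≈Hom Φ F H ψ')
    -- injective
    × (∀ {n m} (F : QVar n) (H : QVar m) (ψ ψ' : Mor F H) →
       Φ F H ψ ≈Hom Φ F H ψ' → ψ ≈Mor ψ')
    -- surjective
    × (∀ {n m} (F : QVar n) (H : QVar m) (h : Hom F H) →
       Σ (Mor F H) λ ψ → Φ F H ψ ≈Hom h)
    -- additive: if ψ'' = ψ + ψ' as maps on F then Φ ψ'' = Φ ψ + Φ ψ'
    × (∀ {n m} (F : QVar n) (H : QVar m) (ψ ψ' ψ'' : Mor F H) →
       (∀ x → x ∈Z F → ∀ j → app ψ'' x j ≈ app ψ x j + app ψ' x j) →
       ∀ (f : Λ m) → Hom.φ (Φ F H ψ'') f ~[ F ] (Hom.φ (Φ F H ψ) f +Λ Hom.φ (Φ F H ψ') f))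
    -- F_q-homogeneous: if ψ' = c ψ as maps on F (c ∈ F_q) then Φ ψ' = c Φ ψ
    × (∀ {n m} (F : QVar n) (H : QVar m) (c : K) → FqScalar c → (ψ ψ' : Mor F H) →
       (∀ x → x ∈Z F → ∀ j → app ψ' x j ≈ c * app ψ x j) →
       ∀ (f : Λ m) → Hom.φ (Φ F H ψ') f ~[ F ] (c ⋆Λ Hom.φ (Φ F H ψ) f))
    -- functorial: composition (contravariant) ...
    × (∀ {n m k} (F : QVar n) (H : QVar m) (L : QVar k)
         (ψ : Mor F H) (χ : Mor H L) (ξ : Mor F L) →
       (∀ x → x ∈Z F → ∀ j → app ξ x j ≈ app χ (app ψ x) j) →
       ∀ (f : Λ k) → Hom.φ (Φ F L ξ) f ~[ F ] (Hom.φ (Φ F H ψ) ∘ Hom.φ (Φ H L χ)) f)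
    -- ... and identities
    × (∀ {n} (F : QVar n) (ξ : Mor F F) →
       (∀ x → x ∈Z F → ∀ j → app ξ x j ≈ x j) →
       ∀ (f : Λ n) → Hom.φ (Φ F F ξ) f ~[ F ] id f)
theorem2p14 𝒮 =
    pullbackHom
  , (λ F H ψ ψ' → pullback-cong F (g ψ) (g ψ'))
  , (λ F H ψ ψ' → pullback-injective F (g ψ) (g ψ'))
  , (λ F H h → homToMor h , pullbackHom-homToMor h)
  , (λ F H ψ ψ' ψ'' → pullback-+ F (g ψ) (g ψ') (g ψ''))
  , (λ F H c c∈Fq ψ ψ' → pullback-Fq-homo F (g ψ) (g ψ') c∈Fq)
  , (λ F H L ψ χ ξ → pullback-∘ F (g ψ) (g χ) (g ξ))
  , (λ F ξ → pullback-id F (g ξ))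
  where
  open Theory 𝒮 using (module Mor)
  open Mor using (g)
  open Pullback 𝒮
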